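{- Let $p$ be a prime and let $\lambda,l$ be positive integers with $2\le l\le p/2$ and $\lambda(p-1)=l^2$. Suppose $\lambda$ has a prime factor $q$ which is a primitive root modulo $p$. Then there is no $(p,2,l;\lambda)$-SEDF in any abelian group of order $p$.
   Context: Let $(G,\cdot)$ be a finite abelian group of order $n$. A pair $\{A_0,A_1\}$ of disjoint subsets of $G$ with $|A_0|=|A_1|=l$ is an $(n,2,l;\lambda)$-strong external difference family (SEDF) in $G$ if $A_0A_1^{(-1)}=\lambda(G-1_G)$ and $A_1A_0^{(-1)}=\lambda(G-1_G)$ in the group ring $\mathbb{Z}[G]$, i.e. every $g\ne1_G$ occurs exactly $\lambda$ times, and $1_G$ does not occur, in the multiset $\{\{ab^{ -1}:a\in A_0,b\in A_1\}\}$ (and likewise with $A_0,A_1$ swapped). -}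

module Defs where

open import Level using (Level)
open import Data.Nat using (ℕ; _+_; _*_; _^_; _<_; _≤_)
open import Data.Nat.Divisibility using (_∣_)
open import Data.Fin using (Fin)
open import Data.Fin.Subset using (Subset; _∈_; _∉_; ∣_∣)
open import Data.Fin.Subset.Properties using (_∈?_)
open import Data.Product using (_×_; _,_; ∃; ∃-syntax)
open import Data.List using (List; length; filter; cartesianProduct; allFin)
open import Relation.Nullary using (¬_; Dec; _×-dec_)
open import Relation.Binary using (Decidable)
open import Relation.Binary.PropositionalEquality using (_≡_)
open import Function using (Injective)
open import Algebra.Bundles using (AbelianGroup)

_≡_[mod_] : ℕ → ℕ → ℕ → Set
a ≡ b [mod p ] = ∃[ x ] ∃[ y ] (a + x * p ≡ b + y * p)

-- q is a primitive root modulo p: q is a unit mod p and its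
-- multiplicative order mod p is p - 1 (no smaller positive power is 1).
IsPrimitiveRoot : ℕ → ℕ → Set
IsPrimitiveRoot q p =
  ¬ (p ∣ q) × (∀ k → 1 ≤ k → k + 1 < p → ¬ ((q ^ k) ≡ 1 [mod p ]))

module _ {c ℓ : Level} (G : AbelianGroup c ℓ) where
  open AbelianGroup G

  record FiniteOrder (n : ℕ) : Set (c Level.⊔ ℓ) where
    field
      enum       : Fin n → Carrier
      injective  : ∀ i j → enum i ≈ enum j → i ≡ j
      surjective : ∀ g → ∃[ i ] (enum i ≈ g)

  -- Number of pairs (a,b) ∈ A₀ × A₁ with a ∙ b⁻¹ ≈ g, where subsets of G are
  -- given as subsets of Fin n transported along the enumeration.
  diffCount : ∀ {n} → Decidable _≈_ → FiniteOrder n →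
              Subset n → Subset n → Carrier → ℕ
  diffCount {n} _≟_ F A₀ A₁ g =
    length (filter (λ { (i , j) → (i ∈? A₀) ×-dec ((j ∈? A₁) ×-dec ((enum i ∙ (enum j) ⁻¹) ≟ g)) })
                   (cartesianProduct (allFin n) (allFin n)))
    where open FiniteOrder F

  record IsSEDF {n : ℕ} (_≟_ : Decidable _≈_) (F : FiniteOrder n)
                (l λ' : ℕ) (A₀ A₁ : Subset n) : Set (c Level.⊔ ℓ) where
    field
      disjoint  : ∀ i → i ∈ A₀ → i ∉ A₁
      size₀     : ∣ A₀ ∣ ≡ l
      size₁     : ∣ A₁ ∣ ≡ l
      identity₀₁ : diffCount _≟_ F A₀ A₁ ε ≡ 0
      identity₁₀ : diffCount _≟_ F A₁ A₀ ε ≡ 0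
      other₀₁   : ∀ g → ¬ (g ≈ ε) → diffCount _≟_ F A₀ A₁ g ≡ λ'
      other₁₀   : ∀ g → ¬ (g ≈ ε) → diffCount _≟_ F A₁ A₀ g ≡ λ'

-- Since q ∣ λ, the SEDF equation A₀A₁⁻¹ = λ(G − 1) says that A₀A₁⁻¹ = 0 in the group ring 𝔽_q[G].
-- Fix a₀ ∈ A₀, b₀ ∈ A₁ and put X = a₀⁻¹A₀, Y = A₁⁻¹, so XY = 0 as well. In characteristic q the
-- Frobenius map gives X^(q^i) = Σ_{x ∈ X} x^(q^i), hence X^(q^i) Y = 0 for every i. As q is a
-- primitive root mod p and |G| = p, the points x^(q^i), 0 ≤ i < p − 1, run once through G ∖ {1}
-- for x ≠ 1 and stay at 1 for x = 1. So evaluating Σ_{i < p−1} X^(q^i) Y at b₀⁻¹ counts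
-- (p − 1) + (l − 1)², which must vanish mod q. Together with q ∣ l (from λ(p − 1) = l²) this
-- gives q ∣ p, contradicting that q is a unit mod p.

module Submission where

open import Defs
open import Level using (Level)
open import Data.Nat using (ℕ; _*_; _∸_; _≤_)
open import Data.Nat.Divisibility using (_∣_)
open import Data.Nat.Primality using (Prime)
open import Data.Fin.Subset using (Subset)
open import Data.Product using (∃-syntax; _×_)
open import Relation.Nullary using (¬_)
open import Relation.Binary using (Decidable)
open import Relation.Binary.PropositionalEquality using (_≡_)
open import Algebra.Bundles using (AbelianGroup)

open import Level using (0ℓ)
open import Algebra.Bundles using (CommutativeMonoid; CommutativeSemiring; Group; Monoid)
open import Algebra.Core using (Op₁; Op₂)
open import Algebra.Morphism.Structures using (IsGroupMonomorphism)
open import Algebra.Structures using (IsAbelianGroup; IsCommutativeMonoid)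
open import Algebra.Structures.Biased using (isCommutativeMonoidˡ; isCommutativeSemiringˡ)
import Algebra.Morphism.GroupMonomorphism as GroupMonomorphism
import Algebra.Properties.CommutativeMonoid.Sum as CommutativeMonoidSum
import Algebra.Properties.CommutativeSemiring.Binomial as Binomial
import Algebra.Properties.Group as GroupProperties
import Algebra.Properties.Monoid.Mult as MonoidMult
import Algebra.Properties.Semiring.Exp as SemiringExp
import Algebra.Properties.Semiring.Mult as SemiringMult
import Algebra.Properties.Semiring.Sum as SemiringSum
open import Data.Bool using (true; false; if_then_else_)
open import Data.Empty using (⊥-elim)
open import Data.Fin using (Fin; zero; suc; toℕ; fromℕ)
open import Data.Fin.Permutation using (permutation)
open import Data.Fin.Properties using (_≟_; 0≢1+n; toℕ<n; toℕ-injective; toℕ-fromℕ)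
  renaming (suc-injective to Fin-suc-injective)
open import Data.Fin.Subset using (_∈_; ∣_∣; inside; outside; Nonempty)
open import Data.Fin.Subset.Properties using (_∈?_; nonempty?; Empty-unique; ∣⊥∣≡0)
open import Data.List using (List; length; filter; cartesianProduct; allFin; map; tabulate; _++_)
open import Data.List.Properties using (length-++; filter-++)
open import Data.Nat using (zero; suc; _+_; _^_; _<_; z≤n; s≤s; _!; NonZero; ≢-nonZero; nonTrivial⇒n>1)
open import Data.Nat.Coprimality using (Coprime; coprime-Bézout)
open import Data.Nat.Combinatorics using (_C_; nCn≡1; k![n∸k]!∣n!)
open import Data.Nat.Combinatorics.Specification using (nCk≡n!/k![n-k]!)
open import Data.Nat.DivMod using (_%_; _/_; %-distribˡ-+; %-distribˡ-*; m*n%n≡0; m/n*n≡m)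
open import Data.Nat.Divisibility
  using (_∣?_; divides; ∣-refl; ∣⇒≤; ∣1⇒≡1; m∣m*n; ∣m⇒∣m*n; ∣n⇒∣m*n; ∣m+n∣m⇒∣n; ∣m∣n⇒∣m+n; m%n≡0⇒n∣m; n∣m⇒m%n≡0)
open import Data.Nat.GCD using (module Bézout)
open import Data.Nat.Primality using (prime⇒irreducible; prime⇒nonTrivial; prime⇒nonZero; euclidsLemma)
open import Data.Nat.Properties hiding (_≟_; 0≢1+n)
open import Data.Nat.Tactic.RingSolver using (solve-∀)
open import Data.Product using (_,_; proj₁; proj₂)
open import Data.Sum using (inj₁; inj₂; [_,_]′)
open import Data.Vec using ([]; _∷_)
open import Function using (_∘_; id)
open import Function.Definitions using (Injective)
open import Relation.Binary.Definitions using (tri<; tri≈; tri>)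
open import Relation.Binary.Structures using (IsEquivalence)
open import Relation.Nullary using (Dec; yes; no; does; _×-dec_; decidable-stable)
open import Relation.Unary using (Pred) renaming (Decidable to Decidable₁)
open import Relation.Binary.PropositionalEquality hiding ([_])
import Relation.Binary.Reasoning.Setoid as SetoidReasoning

open SemiringSum +-*-semiring using (sum; sum-cong-≗; ∑-comm; ∑-distrib-+; *-distribˡ-sum; *-distribʳ-sum)

[_] : ∀ {a} {P : Set a} → Dec P → ℕ
[ d ] = if does d then 1 else 0

module _ {a} {P : Set a} where

  []≡1 : (d : Dec P) → P → [ d ] ≡ 1
  []≡1 (yes _) _ = refl
  []≡1 (no ¬p) p = ⊥-elim (¬p p)

  []≡0 : (d : Dec P) → ¬ P → [ d ] ≡ 0
  []≡0 (yes p) ¬p = ⊥-elim (¬p p)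
  []≡0 (no _) _ = refl

  []≤1 : (d : Dec P) → [ d ] ≤ 1
  []≤1 (yes _) = s≤s z≤n
  []≤1 (no _) = z≤n

module _ {a b} {P : Set a} {Q : Set b} where

  []-cong : (d : Dec P) (e : Dec Q) → (P → Q) → (Q → P) → [ d ] ≡ [ e ]
  []-cong (yes p) e to from = sym ([]≡1 e (to p))
  []-cong (no ¬p) e to from = sym ([]≡0 e (λ q → ¬p (from q)))

  []-×-dec : (d : Dec P) (e : Dec Q) → [ d ×-dec e ] ≡ [ d ] * [ e ]
  []-×-dec (yes _) (yes _) = refl
  []-×-dec (yes _) (no _) = refl
  []-×-dec (no _) _ = refl

[≟]-sym : ∀ {n} (x y : Fin n) → [ x ≟ y ] ≡ [ y ≟ x ]
[≟]-sym x y = []-cong (x ≟ y) (y ≟ x) sym sym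

sum-zero : ∀ {n} (f : Fin n → ℕ) → (∀ i → f i ≡ 0) → sum f ≡ 0
sum-zero {zero} f f≡0 = refl
sum-zero {suc n} f f≡0 = cong₂ _+_ (f≡0 zero) (sum-zero (λ i → f (suc i)) (λ i → f≡0 (suc i)))

sum-const : ∀ n (c : ℕ) → sum {n} (λ _ → c) ≡ n * c
sum-const zero c = refl
sum-const (suc n) c = cong (c +_) (sum-const n c)

sum-δ : ∀ {n} (x : Fin n) (f : Fin n → ℕ) → sum (λ y → [ x ≟ y ] * f y) ≡ f x
sum-δ {suc n} zero f = trans (cong₂ _+_ (*-identityˡ (f zero)) (sum-zero {n} _ (λ _ → refl))) (+-identityʳ _)
sum-δ {suc n} (suc x) f = sum-δ x (λ y → f (suc y))

sum-≤ : ∀ {n} (f : Fin n → ℕ) → (∀ i → f i ≤ 1) → sum f ≤ n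
sum-≤ {zero} f f≤1 = z≤n
sum-≤ {suc n} f f≤1 = +-mono-≤ (f≤1 zero) (sum-≤ (λ i → f (suc i)) (λ i → f≤1 (suc i)))

sum≡n⇒≡1 : ∀ {n} (f : Fin n → ℕ) → (∀ i → f i ≤ 1) → sum f ≡ n → ∀ i → f i ≡ 1
sum≡n⇒≡1 {suc n} f f≤1 sum≡ i with f zero in f0≡ | f≤1 zero
... | zero | _ = ⊥-elim (<-irrefl refl (subst (_≤ n) sum≡ (sum-≤ (λ i → f (suc i)) (λ i → f≤1 (suc i)))))
... | suc (suc _) | s≤s ()
... | suc zero | _ with i
...   | zero = f0≡
...   | suc i = sum≡n⇒≡1 (λ i → f (suc i)) (λ i → f≤1 (suc i)) (suc-injective sum≡) i

fiber : ∀ {m n} → (Fin m → Fin n) → Fin n → ℕ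
fiber f y = sum (λ i → [ f i ≟ y ])

fiber≤1 : ∀ {m n} (f : Fin m → Fin n) → Injective _≡_ _≡_ f → ∀ y → fiber f y ≤ 1
fiber≤1 {zero} f inj y = z≤n
fiber≤1 {suc m} f inj y with f zero ≟ y
... | yes f0≡y = ≤-reflexive (cong suc (sum-zero {m} _ (λ i →
        []≡0 (f (suc i) ≟ y) (λ fi≡y → 0≢1+n (inj (trans f0≡y (sym fi≡y)))))))
... | no _ = fiber≤1 (f ∘ suc) (Fin-suc-injective ∘ inj) y

∑-fiber : ∀ {m n} (f : Fin m → Fin n) → sum (fiber f) ≡ m
∑-fiber {m} {n} f = begin
  sum (λ y → sum (λ i → [ f i ≟ y ]))       ≡⟨ ∑-comm (λ y i → [ f i ≟ y ]) ⟩
  sum (λ i → sum (λ y → [ f i ≟ y ]))       ≡⟨ sum-cong-≗ {m} (λ i → trans (sum-cong-≗ {n} (λ y → sym (*-identityʳ _))) (sum-δ (f i) (λ _ → 1))) ⟩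
  sum {m} (λ _ → 1)                         ≡⟨ trans (sum-const m 1) (*-identityʳ m) ⟩
  m                                         ∎
  where open ≡-Reasoning

∑-*-∑ : ∀ {m n} (f : Fin m → ℕ) (g : Fin n → ℕ) → sum (λ a → sum (λ b → f a * g b)) ≡ sum f * sum g
∑-*-∑ {m} f g = trans (sum-cong-≗ {m} (λ a → sym (*-distribˡ-sum (f a) g))) (sym (*-distribʳ-sum (sum g) f))

∑-pull-*ˡ : ∀ {m n} (f : Fin n → ℕ) (g : Fin m → Fin n → ℕ) →
            sum (λ i → sum (λ a → f a * g i a)) ≡ sum (λ a → f a * sum (λ i → g i a))
∑-pull-*ˡ {m} {n} f g = trans (∑-comm (λ i a → f a * g i a)) (sum-cong-≗ {n} (λ a → sym (*-distribˡ-sum (f a) (λ i → g i a))))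

∑-matrix-assoc : ∀ {m n} (f : Fin m → ℕ) (M : Fin m → Fin n → ℕ) (k : Fin n → ℕ) →
                 sum (λ c → sum (λ a → f a * M a c) * k c) ≡ sum (λ a → f a * sum (λ c → M a c * k c))
∑-matrix-assoc {m} {n} f M k = begin
  sum (λ c → sum (λ a → f a * M a c) * k c)    ≡⟨ sum-cong-≗ {n} (λ c → *-distribʳ-sum (k c) (λ a → f a * M a c)) ⟩
  sum (λ c → sum (λ a → f a * M a c * k c))    ≡⟨ ∑-comm (λ c a → f a * M a c * k c) ⟩
  sum (λ a → sum (λ c → f a * M a c * k c))    ≡⟨ sum-cong-≗ {m} (λ a → sum-cong-≗ {n} (λ c → *-assoc (f a) (M a c) (k c))) ⟩
  sum (λ a → sum (λ c → f a * (M a c * k c)))  ≡⟨ sum-cong-≗ {m} (λ a → sym (*-distribˡ-sum (f a) (λ c → M a c * k c))) ⟩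
  sum (λ a → f a * sum (λ c → M a c * k c))    ∎
  where open ≡-Reasoning

∑-pushforward : ∀ {m n} (g : Fin m → ℕ) (φ : Fin m → Fin n) (k : Fin n → ℕ) →
                sum (λ c → sum (λ b → g b * [ φ b ≟ c ]) * k c) ≡ sum (λ b → g b * k (φ b))
∑-pushforward {m} g φ k =
  trans (∑-matrix-assoc g (λ b c → [ φ b ≟ c ]) k) (sum-cong-≗ {m} (λ b → cong (g b *_) (sum-δ (φ b) k)))

∑-split : ∀ {n} (P f : Fin n → ℕ) → (∀ a → P a ≤ 1) →
          sum (λ a → P a * f a) + sum (λ a → (1 ∸ P a) * f a) ≡ sum f
∑-split {n} P f P≤1 = trans (sym (∑-distrib-+ (λ a → P a * f a) (λ a → (1 ∸ P a) * f a)))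
  (sum-cong-≗ {n} (λ a → trans (sym (*-distribʳ-+ (f a) (P a) (1 ∸ P a)))
    (trans (cong (_* f a) (m+[n∸m]≡n (P≤1 a))) (*-identityˡ (f a)))))

∑∑-rank-two : ∀ {m n} (f : Fin m → ℕ) (g : Fin n → ℕ) (k : ℕ) (P P′ : Fin m → ℕ) (Q Q′ : Fin n → ℕ) →
  sum (λ a → f a * sum (λ b → g b * (k * P a * Q b + P′ a * Q′ b)))
    ≡ k * sum (λ a → P a * f a) * sum (λ b → Q b * g b) + sum (λ a → P′ a * f a) * sum (λ b → Q′ b * g b)
∑∑-rank-two {m} {n} f g k P P′ Q Q′ = begin
  sum (λ a → f a * sum (λ b → g b * (k * P a * Q b + P′ a * Q′ b)))
    ≡⟨ sum-cong-≗ {m} (λ a → trans (*-distribˡ-sum {n} (f a) _) (sum-cong-≗ {n} (λ b → expand (f a) (g b) k (P a) (Q b) (P′ a) (Q′ b)))) ⟩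
  sum (λ a → sum (λ b → k * (P a * f a) * (Q b * g b) + P′ a * f a * (Q′ b * g b)))
    ≡⟨ sum-cong-≗ {m} (λ a → ∑-distrib-+ (λ b → k * (P a * f a) * (Q b * g b)) (λ b → P′ a * f a * (Q′ b * g b))) ⟩
  sum (λ a → sum (λ b → k * (P a * f a) * (Q b * g b)) + sum (λ b → P′ a * f a * (Q′ b * g b)))
    ≡⟨ ∑-distrib-+ (λ a → sum (λ b → k * (P a * f a) * (Q b * g b))) (λ a → sum (λ b → P′ a * f a * (Q′ b * g b))) ⟩
  sum (λ a → sum (λ b → k * (P a * f a) * (Q b * g b))) + sum (λ a → sum (λ b → P′ a * f a * (Q′ b * g b)))
    ≡⟨ cong₂ _+_ (trans (∑-*-∑ (λ a → k * (P a * f a)) (λ b → Q b * g b)) (cong (_* sum (λ b → Q b * g b)) (sym (*-distribˡ-sum k (λ a → P a * f a)))))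
                 (∑-*-∑ (λ a → P′ a * f a) (λ b → Q′ b * g b)) ⟩
  k * sum (λ a → P a * f a) * sum (λ b → Q b * g b) + sum (λ a → P′ a * f a) * sum (λ b → Q′ b * g b) ∎
  where
  open ≡-Reasoning
  expand : ∀ x y k P Q P′ Q′ → x * (y * (k * P * Q + P′ * Q′)) ≡ k * (P * x) * (Q * y) + P′ * x * (Q′ * y)
  expand = solve-∀

module Modulo (q : ℕ) .{{_ : NonZero q}} where

  infix 4 _~_
  _~_ : ℕ → ℕ → Set
  a ~ b = a % q ≡ b % q

  ~0⇒∣ : ∀ {a} → a ~ 0 → q ∣ a
  ~0⇒∣ {a} a~0 = m%n≡0⇒n∣m a q (trans a~0 (m*n%n≡0 0 q))

  ∣⇒~0 : ∀ {a} → q ∣ a → a ~ 0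
  ∣⇒~0 {a} q∣a = trans (n∣m⇒m%n≡0 a q q∣a) (sym (m*n%n≡0 0 q))

  ~-+ : ∀ {a a′ b b′} → a ~ a′ → b ~ b′ → a + b ~ a′ + b′
  ~-+ {a} {a′} {b} {b′} a~ b~ =
    trans (%-distribˡ-+ a b q) (trans (cong₂ (λ x y → (x + y) % q) a~ b~) (sym (%-distribˡ-+ a′ b′ q)))

  ~-* : ∀ {a a′ b b′} → a ~ a′ → b ~ b′ → a * b ~ a′ * b′
  ~-* {a} {a′} {b} {b′} a~ b~ =
    trans (%-distribˡ-* a b q) (trans (cong₂ (λ x y → (x * y) % q) a~ b~) (sym (%-distribˡ-* a′ b′ q)))

  ~-sum : ∀ {m} (f g : Fin m → ℕ) → (∀ i → f i ~ g i) → sum f ~ sum g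
  ~-sum {zero} f g f~g = refl
  ~-sum {suc m} f g f~g = ~-+ (f~g zero) (~-sum (f ∘ suc) (g ∘ suc) (f~g ∘ suc))

  ~-sum-ends : ∀ m (f : Fin (suc m) → ℕ) → 0 < m → (∀ i → 0 < toℕ i → toℕ i < m → f i ~ 0) →
               sum f ~ f zero + f (fromℕ m)
  ~-sum-ends (suc m) f _ inner~0 = ~-+ {f zero} refl (~-sum-last m (f ∘ suc) (λ i i<m → inner~0 (suc i) (s≤s z≤n) (s≤s i<m)))
    where
    ~-sum-last : ∀ m (g : Fin (suc m) → ℕ) → (∀ i → toℕ i < m → g i ~ 0) → sum g ~ g (fromℕ m)
    ~-sum-last zero g _ = cong (_% q) (+-identityʳ (g zero))
    ~-sum-last (suc m) g g~0 = ~-+ {g zero} {0} (g~0 zero (s≤s z≤n)) (~-sum-last m (g ∘ suc) (λ i i<m → g~0 (suc i) (s≤s i<m)))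

prime∤⇒coprime : ∀ {p d} → Prime p → ¬ p ∣ d → Coprime p d
prime∤⇒coprime p-prime p∤d (i∣p , i∣d) with prime⇒irreducible p-prime i∣p
... | inj₁ i≡1 = i≡1
... | inj₂ refl = ⊥-elim (p∤d i∣d)

prime∤^ : ∀ {p q} → Prime p → ¬ p ∣ q → ∀ k → ¬ p ∣ q ^ k
prime∤^ p-prime p∤q zero p∣1 = <⇒≢ (nonTrivial⇒n>1 _ {{prime⇒nonTrivial p-prime}}) (sym (∣1⇒≡1 p∣1))
prime∤^ {q = q} p-prime p∤q (suc k) p∣q^k+1 with euclidsLemma q (q ^ k) p-prime p∣q^k+1
... | inj₁ p∣q = p∤q p∣q
... | inj₂ p∣q^k = prime∤^ p-prime p∤q k p∣q^k

∣∸⇒≡[mod] : ∀ {p a b} → b ≤ a → p ∣ a ∸ b → a ≡ b [mod p ]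
∣∸⇒≡[mod] {a = a} {b} b≤a (divides c a∸b≡cp) = 0 , c , (begin
  a + 0       ≡⟨ +-identityʳ a ⟩
  a           ≡⟨ m+[n∸m]≡n b≤a ⟨
  b + (a ∸ b) ≡⟨ cong (b +_) a∸b≡cp ⟩
  b + _       ∎)
  where open ≡-Reasoning

prime∣!⇒≤ : ∀ {p} m → Prime p → p ∣ m ! → p ≤ m
prime∣!⇒≤ zero p-prime p∣1 = ⊥-elim (<⇒≢ (nonTrivial⇒n>1 _ {{prime⇒nonTrivial p-prime}}) (sym (∣1⇒≡1 p∣1)))
prime∣!⇒≤ (suc m) p-prime p∣m+1! with euclidsLemma (suc m) (m !) p-prime p∣m+1!
... | inj₁ p∣m+1 = ∣⇒≤ p∣m+1
... | inj₂ p∣m! = m≤n⇒m≤1+n (prime∣!⇒≤ m p-prime p∣m!)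

nCk*k![n∸k]!≡n! : ∀ {n k} → k ≤ n → (n C k) * (k ! * (n ∸ k) !) ≡ n !
nCk*k![n∸k]!≡n! {n} {k} k≤n = trans (cong (_* (k ! * (n ∸ k) !)) (nCk≡n!/k![n-k]! k≤n)) (m/n*n≡m (k![n∸k]!∣n! k≤n))
  where instance _ = k !* (n ∸ k) !≢0

-- p divides p! = (p C k) · k! · (p ∸ k)! but neither k! nor (p ∸ k)!, whose factors are all below p.
prime∣pCk : ∀ {p k} → Prime p → 0 < k → k < p → p ∣ p C k
prime∣pCk {p} {k} p-prime 0<k k<p
  with euclidsLemma (p C k) (k ! * (p ∸ k) !) p-prime (subst (p ∣_) (sym (nCk*k![n∸k]!≡n! (<⇒≤ k<p))) p∣p!)
  where
  p∣p! : p ∣ p !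
  p∣p! = n∣n! p (<-≤-trans 0<k (<⇒≤ k<p))
    where
    n∣n! : ∀ n → 0 < n → n ∣ n !
    n∣n! (suc n) _ = m∣m*n (n !)
... | inj₁ p∣pCk = p∣pCk
... | inj₂ p∣k![p∸k]! with euclidsLemma (k !) ((p ∸ k) !) p-prime p∣k![p∸k]!
...   | inj₁ p∣k! = ⊥-elim (<⇒≱ k<p (prime∣!⇒≤ k p-prime p∣k!))
...   | inj₂ p∣[p∸k]! = ⊥-elim (<⇒≱ (∸-monoʳ-< 0<k (<⇒≤ k<p)) (prime∣!⇒≤ (p ∸ k) p-prime p∣[p∸k]!))

-- Finite abelian groups and Frobenius orbits

module FiniteAbelianGroup {n : ℕ} {_·_ : Op₂ (Fin n)} {ε : Fin n} {_⁻¹ : Op₁ (Fin n)}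
                          (isAbelianGroup : IsAbelianGroup _≡_ _·_ ε _⁻¹) where

  open IsAbelianGroup isAbelianGroup using (isGroup; isCommutativeMonoid; assoc; comm; identityˡ; identityʳ; inverseˡ; inverseʳ)

  group : Group 0ℓ 0ℓ
  group = record { isGroup = isGroup }

  commutativeMonoid : CommutativeMonoid 0ℓ 0ℓ
  commutativeMonoid = record { isCommutativeMonoid = isCommutativeMonoid }

  open GroupProperties group using (∙-cancelˡ; \\-leftDividesˡ; //-rightDividesˡ; //-rightDividesʳ)
  open CommutativeMonoid commutativeMonoid using (monoid)
  open MonoidMult monoid using (×-homo-+; ×-assocˡ) renaming (_×_ to pow; ×-homo-1 to pow-1)
  open CommutativeMonoidSum commutativeMonoid using ()
    renaming (sum to ∏; ∑-distrib-+ to ∏-distrib-·; ∑-permute to ∏-permute; sum-replicate to ∏-const)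

  pow-+ : ∀ m k a → pow (m + k) a ≡ pow m a · pow k a
  pow-+ m k a = ×-homo-+ a m k

  pow-* : ∀ m k a → pow (m * k) a ≡ pow m (pow k a)
  pow-* m k a = sym (×-assocˡ a m k)

  pow-ε : ∀ m → pow m ε ≡ ε
  pow-ε zero = refl
  pow-ε (suc m) = trans (identityˡ _) (pow-ε m)

  -- Translation by a permutes the group, so ∏ᵢ i = ∏ᵢ (a · i) = aⁿ · ∏ᵢ i.
  pow-card≡ε : ∀ a → pow n a ≡ ε
  pow-card≡ε a = ∙-cancelˡ (∏ (λ i → i)) (pow n a) ε (begin
    ∏ (λ i → i) · pow n a       ≡⟨ comm _ _ ⟩
    pow n a · ∏ (λ i → i)       ≡⟨ cong (_· ∏ (λ i → i)) (∏-const n {a}) ⟨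
    ∏ {n} (λ _ → a) · ∏ (λ i → i) ≡⟨ ∏-distrib-· (λ _ → a) (λ i → i) ⟨
    ∏ (λ i → a · i)             ≡⟨ ∏-permute (λ i → i) translation ⟨
    ∏ (λ i → i)                 ≡⟨ identityʳ _ ⟨
    ∏ (λ i → i) · ε             ∎)
    where
    open ≡-Reasoning
    translation = permutation (a ·_) (a ⁻¹ ·_)
      (λ y → trans (sym (assoc _ _ _)) (trans (cong (_· y) (inverseʳ a)) (identityˡ y)))
      (λ y → trans (sym (assoc _ _ _)) (trans (cong (_· y) (inverseˡ a)) (identityˡ y)))

  pow-*≡ε : ∀ x {d a} → pow d a ≡ ε → pow (x * d) a ≡ ε
  pow-*≡ε x {d} {a} pow≡ε = trans (pow-* x d a) (trans (cong (pow x) pow≡ε) (pow-ε x))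

  pow-+≡ε : ∀ g m {a} → pow (g + m) a ≡ ε → pow m a ≡ ε → pow g a ≡ ε
  pow-+≡ε g m {a} sum≡ε m≡ε = trans (sym (identityʳ _)) (trans (cong (pow g a ·_) (sym m≡ε)) (trans (sym (pow-+ g m a)) sum≡ε))

  pow-Bézout≡ε : ∀ {g m k a} → Bézout.Identity g m k → pow m a ≡ ε → pow k a ≡ ε → pow g a ≡ ε
  pow-Bézout≡ε {g} {m} {k} {a} (Bézout.+- x y eq) m≡ε k≡ε =
    pow-+≡ε g (y * k) (trans (cong (λ e → pow e a) eq) (pow-*≡ε x m≡ε)) (pow-*≡ε y k≡ε)
  pow-Bézout≡ε {g} {m} {k} {a} (Bézout.-+ x y eq) m≡ε k≡ε =
    pow-+≡ε g (x * m) (trans (cong (λ e → pow e a) eq) (pow-*≡ε y k≡ε)) (pow-*≡ε x m≡ε)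

  pow-≡⇒pow-∸≡ε : ∀ {m k} a → m ≤ k → pow m a ≡ pow k a → pow (k ∸ m) a ≡ ε
  pow-≡⇒pow-∸≡ε {m} {k} a m≤k eq = ∙-cancelˡ (pow m a) _ _ (begin
    pow m a · pow (k ∸ m) a     ≡⟨ pow-+ m (k ∸ m) a ⟨
    pow (m + (k ∸ m)) a         ≡⟨ cong (λ e → pow e a) (m+[n∸m]≡n m≤k) ⟩
    pow k a                     ≡⟨ eq ⟨
    pow m a                     ≡⟨ identityʳ _ ⟨
    pow m a · ε                 ∎)
    where open ≡-Reasoning

  [·⁻¹≟]≡[≟·] : ∀ z b h → [ z · (b ⁻¹) ≟ h ] ≡ [ z ≟ h · b ]
  [·⁻¹≟]≡[≟·] z b h = []-cong (z · (b ⁻¹) ≟ h) (z ≟ h · b)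
    (λ { refl → sym (//-rightDividesˡ b z) }) (λ { refl → //-rightDividesʳ b h })

  [ε≟⁻¹·]≡[≟] : ∀ a₀ a → [ ε ≟ (a₀ ⁻¹) · a ] ≡ [ a₀ ≟ a ]
  [ε≟⁻¹·]≡[≟] a₀ a = []-cong (ε ≟ (a₀ ⁻¹) · a) (a₀ ≟ a)
    (λ ε≡ → trans (sym (identityʳ a₀)) (trans (cong (a₀ ·_) ε≡) (\\-leftDividesˡ a₀ a))) (λ { refl → sym (inverseˡ a₀) })

  module PrimeOrder (n-prime : Prime n) where

    pow≡ε⇒∣ : ∀ {a d} → a ≢ ε → pow d a ≡ ε → n ∣ d
    pow≡ε⇒∣ {a} {d} a≢ε d≡ε = decidable-stable (n ∣? d) λ n∤d →
      a≢ε (trans (sym (pow-1 a)) (pow-Bézout≡ε (coprime-Bézout (prime∤⇒coprime n-prime n∤d)) (pow-card≡ε a) d≡ε))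

    module PrimitiveRoot {q : ℕ} (q-primitive : IsPrimitiveRoot q n) where

      private
        n∤q = proj₁ q-primitive

        instance
          q≢0 : NonZero q
          q≢0 = ≢-nonZero λ { refl → n∤q (divides 0 refl) }

        1≤n : 1 ≤ n
        1≤n = <⇒≤ (nonTrivial⇒n>1 n {{prime⇒nonTrivial n-prime}})

      orbit : Fin n → Fin (n ∸ 1) → Fin n
      orbit u i = pow (q ^ toℕ i) u

      orbit-≢ε : ∀ {u} → u ≢ ε → ∀ i → orbit u i ≢ ε
      orbit-≢ε u≢ε i orbit≡ε = prime∤^ n-prime n∤q (toℕ i) (pow≡ε⇒∣ u≢ε orbit≡ε)

      q^-∸ : ∀ {i j} → i ≤ j → q ^ j ∸ q ^ i ≡ q ^ i * (q ^ (j ∸ i) ∸ 1)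
      q^-∸ {i} {j} i≤j = begin
        q ^ j ∸ q ^ i                     ≡⟨ cong (λ e → q ^ e ∸ q ^ i) (m+[n∸m]≡n i≤j) ⟨
        q ^ (i + (j ∸ i)) ∸ q ^ i         ≡⟨ cong₂ _∸_ (^-distribˡ-+-* q i (j ∸ i)) (sym (*-identityʳ (q ^ i))) ⟩
        q ^ i * q ^ (j ∸ i) ∸ q ^ i * 1   ≡⟨ *-distribˡ-∸ (q ^ i) (q ^ (j ∸ i)) 1 ⟨
        q ^ i * (q ^ (j ∸ i) ∸ 1)         ∎
        where open ≡-Reasoning

      -- u^(q^j) = u^(q^i) forces n ∣ q^j - q^i, i.e. q^(j-i) ≡ 1 (mod n) with 0 < j - i < n - 1.
      orbit-distinct : ∀ {u} → u ≢ ε → ∀ i j → toℕ i < toℕ j → orbit u i ≢ orbit u j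
      orbit-distinct {u} u≢ε i j i<j eq = proj₂ q-primitive k (m<n⇒0<n∸m i<j) k+1<n q^k≡1
        where
        k = toℕ j ∸ toℕ i
        k+1<n : k + 1 < n
        k+1<n = subst (k + 1 <_) (m∸n+n≡m 1≤n)
                  (+-monoˡ-< 1 (≤-<-trans (m∸n≤m (toℕ j) (toℕ i)) (toℕ<n j)))
        n∣q^k∸1 : n ∣ q ^ k ∸ 1
        n∣q^k∸1 with euclidsLemma (q ^ toℕ i) (q ^ k ∸ 1) n-prime
               (subst (n ∣_) (q^-∸ (<⇒≤ i<j)) (pow≡ε⇒∣ u≢ε (pow-≡⇒pow-∸≡ε u (^-monoʳ-≤ q (<⇒≤ i<j)) eq)))
        ... | inj₁ n∣q^i = ⊥-elim (prime∤^ n-prime n∤q (toℕ i) n∣q^i)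
        ... | inj₂ n∣q^k∸1 = n∣q^k∸1
        q^k≡1 : (q ^ k) ≡ 1 [mod n ]
        q^k≡1 = ∣∸⇒≡[mod] (m^n>0 q k) n∣q^k∸1

      orbit-injective : ∀ {u} → u ≢ ε → Injective _≡_ _≡_ (orbit u)
      orbit-injective u≢ε {i} {j} eq with <-cmp (toℕ i) (toℕ j)
      ... | tri< i<j _ _ = ⊥-elim (orbit-distinct u≢ε i j i<j eq)
      ... | tri≈ _ i≡j _ = toℕ-injective i≡j
      ... | tri> _ _ j<i = ⊥-elim (orbit-distinct u≢ε j i j<i (sym eq))

      fiber-orbit-ε : ∀ y → fiber (orbit ε) y ≡ (n ∸ 1) * [ ε ≟ y ]
      fiber-orbit-ε y = trans (sum-cong-≗ {n ∸ 1} (λ i → cong (λ z → [ z ≟ y ]) (pow-ε (q ^ toℕ i))))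
                              (sum-const (n ∸ 1) [ ε ≟ y ])

      -- Pigeonhole: n - 1 distinct orbit points avoiding ε exhaust the other n - 1 elements.
      fiber-orbit-≢ε : ∀ {u} → u ≢ ε → ∀ y → fiber (orbit u) y ≡ 1 ∸ [ ε ≟ y ]
      fiber-orbit-≢ε {u} u≢ε y = trans (sym (m+n∸n≡m _ [ ε ≟ y ])) (cong (_∸ [ ε ≟ y ]) (sum≡n⇒≡1 count count≤1 ∑count y))
        where
        count : Fin n → ℕ
        count y = fiber (orbit u) y + [ ε ≟ y ]
        count≤1 : ∀ y → count y ≤ 1
        count≤1 y with ε ≟ y
        ... | yes refl = ≤-reflexive (cong (_+ 1) (sum-zero {n ∸ 1} _ (λ i → []≡0 (orbit u i ≟ ε) (orbit-≢ε u≢ε i))))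
        ... | no _ = ≤-trans (≤-reflexive (+-identityʳ _)) (fiber≤1 (orbit u) (orbit-injective u≢ε) y)
        ∑count : sum count ≡ n
        ∑count = begin
          sum count                                         ≡⟨ ∑-distrib-+ (fiber (orbit u)) (λ y → [ ε ≟ y ]) ⟩
          sum (fiber (orbit u)) + sum (λ y → [ ε ≟ y ])     ≡⟨ cong₂ _+_ (∑-fiber (orbit u)) (trans (sum-cong-≗ {n} (λ y → sym (*-identityʳ _))) (sum-δ ε (λ _ → 1))) ⟩
          (n ∸ 1) + 1                                       ≡⟨ m∸n+n≡m 1≤n ⟩
          n                                                 ∎
          where open ≡-Reasoning

      fiber-orbit : ∀ u y → fiber (orbit u) y ≡ (n ∸ 1) * [ ε ≟ u ] * [ ε ≟ y ] + (1 ∸ [ ε ≟ u ]) * (1 ∸ [ ε ≟ y ])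
      fiber-orbit u y with ε ≟ u
      ... | yes refl = trans (fiber-orbit-ε y) (trans (cong (_* [ ε ≟ y ]) (sym (*-identityʳ (n ∸ 1)))) (sym (+-identityʳ _)))
      ... | no ε≢u = trans (fiber-orbit-≢ε (ε≢u ∘ sym) y)
                       (sym (cong₂ _+_ (cong (_* [ ε ≟ y ]) (*-zeroʳ (n ∸ 1))) (*-identityˡ _)))

-- The monoid semiring modulo q and the Frobenius map

module MonoidSemiring {n : ℕ} {_·_ : Op₂ (Fin n)} {e : Fin n}
                      (isCommutativeMonoid : IsCommutativeMonoid _≡_ _·_ e)
                      (q : ℕ) .{{_ : NonZero q}} where

  open IsCommutativeMonoid isCommutativeMonoid using (assoc; comm; identityˡ)
  open Modulo q

  -- An element Σₐ f(a)·a of the monoid semiring 𝔽_q[M] is its coefficient function f.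
  Element : Set
  Element = Fin n → ℕ

  infix 4 _≈_
  _≈_ : Element → Element → Set
  f ≈ g = ∀ h → f h ~ g h

  infixl 6 _⊕_
  _⊕_ : Element → Element → Element
  (f ⊕ g) h = f h + g h

  infixl 7 _⊛_
  _⊛_ : Element → Element → Element
  (f ⊛ g) h = sum (λ a → f a * sum (λ b → g b * [ a · b ≟ h ]))

  𝟘 : Element
  𝟘 _ = 0

  δ : Fin n → Element
  δ a h = [ a ≟ h ]

  ≗⇒≈ : ∀ {f g} → (∀ h → f h ≡ g h) → f ≈ g
  ≗⇒≈ f≗g h = cong (_% q) (f≗g h)

  δ-⊛ : ∀ t f h → (δ t ⊛ f) h ≡ sum (λ b → f b * [ t · b ≟ h ])
  δ-⊛ t f h = sum-δ t (λ a → sum (λ b → f b * [ a · b ≟ h ]))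

  ⊛-identityˡ : ∀ f h → (δ e ⊛ f) h ≡ f h
  ⊛-identityˡ f h = begin
    (δ e ⊛ f) h                          ≡⟨ δ-⊛ e f h ⟩
    sum (λ b → f b * [ e · b ≟ h ])      ≡⟨ sum-cong-≗ {n} (λ b → trans (*-comm (f b) _) (cong (λ z → [ z ≟ h ] * f b) (identityˡ b))) ⟩
    sum (λ b → [ b ≟ h ] * f b)          ≡⟨ sum-cong-≗ {n} (λ b → cong (_* f b) ([≟]-sym b h)) ⟩
    sum (λ b → [ h ≟ b ] * f b)          ≡⟨ sum-δ h f ⟩
    f h                                  ∎
    where open ≡-Reasoning

  ⊛-comm : ∀ f g h → (f ⊛ g) h ≡ (g ⊛ f) h
  ⊛-comm f g h = begin
    sum (λ a → f a * sum (λ b → g b * [ a · b ≟ h ]))     ≡⟨ sum-cong-≗ {n} (λ a → *-distribˡ-sum {n} (f a) _) ⟩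
    sum (λ a → sum (λ b → f a * (g b * [ a · b ≟ h ])))   ≡⟨ ∑-comm (λ a b → f a * (g b * [ a · b ≟ h ])) ⟩
    sum (λ b → sum (λ a → f a * (g b * [ a · b ≟ h ])))   ≡⟨ sum-cong-≗ {n} (λ b → sum-cong-≗ {n} (λ a → swap (f a) (g b) (cong (λ z → [ z ≟ h ]) (comm a b)))) ⟩
    sum (λ b → sum (λ a → g b * (f a * [ b · a ≟ h ])))   ≡⟨ sum-cong-≗ {n} (λ b → *-distribˡ-sum {n} (g b) _) ⟨
    sum (λ b → g b * sum (λ a → f a * [ b · a ≟ h ]))     ∎
    where
    open ≡-Reasoning
    swap : ∀ x y {z z′} → z ≡ z′ → x * (y * z) ≡ y * (x * z′)
    swap x y {z} refl = trans (sym (*-assoc x y z)) (trans (cong (_* z) (*-comm x y)) (*-assoc y x z))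

  ⊛-assoc : ∀ f g k h → ((f ⊛ g) ⊛ k) h ≡ (f ⊛ (g ⊛ k)) h
  ⊛-assoc f g k h = begin
    sum (λ c → sum (λ a → f a * sum (λ b → g b * [ a · b ≟ c ])) * K c)
      ≡⟨ ∑-matrix-assoc f (λ a c → sum (λ b → g b * [ a · b ≟ c ])) K ⟩
    sum (λ a → f a * sum (λ c → sum (λ b → g b * [ a · b ≟ c ]) * K c))
      ≡⟨ sum-cong-≗ {n} (λ a → cong (f a *_) (∑-pushforward g (a ·_) K)) ⟩
    sum (λ a → f a * sum (λ b → g b * sum (λ d → k d * [ (a · b) · d ≟ h ])))
      ≡⟨ sum-cong-≗ {n} (λ a → cong (f a *_) (sum-cong-≗ {n} (λ b → cong (g b *_)
           (sum-cong-≗ {n} (λ d → cong (λ z → k d * [ z ≟ h ]) (assoc a b d)))))) ⟩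
    sum (λ a → f a * sum (λ b → g b * sum (λ d → k d * [ a · (b · d) ≟ h ])))
      ≡⟨ sum-cong-≗ {n} (λ a → cong (f a *_) (sum-cong-≗ {n} (λ b → cong (g b *_) (∑-pushforward k (b ·_) (λ c → [ a · c ≟ h ]))))) ⟨
    sum (λ a → f a * sum (λ b → g b * sum (λ c → sum (λ d → k d * [ b · d ≟ c ]) * [ a · c ≟ h ])))
      ≡⟨ sum-cong-≗ {n} (λ a → cong (f a *_) (∑-matrix-assoc g (λ b c → sum (λ d → k d * [ b · d ≟ c ])) (λ c → [ a · c ≟ h ]))) ⟨
    sum (λ a → f a * sum (λ c → (g ⊛ k) c * [ a · c ≟ h ])) ∎
    where
    open ≡-Reasoning
    K = λ c → sum (λ d → k d * [ c · d ≟ h ])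

  ⊛-distribʳ : ∀ f g k h → ((g ⊕ k) ⊛ f) h ≡ ((g ⊛ f) ⊕ (k ⊛ f)) h
  ⊛-distribʳ f g k h = trans (sum-cong-≗ {n} (λ a → *-distribʳ-+ (sum (λ b → f b * [ a · b ≟ h ])) (g a) (k a)))
    (∑-distrib-+ (λ a → g a * sum (λ b → f b * [ a · b ≟ h ])) (λ a → k a * sum (λ b → f b * [ a · b ≟ h ])))

  ⊛-cong : ∀ {f f′ g g′} → f ≈ f′ → g ≈ g′ → f ⊛ g ≈ f′ ⊛ g′
  ⊛-cong f≈ g≈ h = ~-sum _ _ (λ a → ~-* (f≈ a) (~-sum _ _ (λ b → ~-* (g≈ b) refl)))

  ⊕-cong : ∀ {f f′ g g′} → f ≈ f′ → g ≈ g′ → f ⊕ g ≈ f′ ⊕ g′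
  ⊕-cong f≈ g≈ h = ~-+ (f≈ h) (g≈ h)

  ≈-isEquivalence : IsEquivalence _≈_
  ≈-isEquivalence = record
    { refl = λ h → refl ; sym = λ f≈g h → sym (f≈g h) ; trans = λ f≈g g≈k h → trans (f≈g h) (g≈k h) }

  semiring : CommutativeSemiring 0ℓ 0ℓ
  semiring = record
    { Carrier = Element ; _≈_ = _≈_ ; _+_ = _⊕_ ; _*_ = _⊛_ ; 0# = 𝟘 ; 1# = δ e
    ; isCommutativeSemiring = isCommutativeSemiringˡ (record
      { +-isCommutativeMonoid = isCommutativeMonoidˡ (record
        { isSemigroup = record
          { isMagma = record { isEquivalence = ≈-isEquivalence ; ∙-cong = ⊕-cong }
          ; assoc = λ f g k → ≗⇒≈ (λ h → +-assoc (f h) (g h) (k h)) }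
        ; identityˡ = λ f h → refl
        ; comm = λ f g → ≗⇒≈ (λ h → +-comm (f h) (g h)) })
      ; *-isCommutativeMonoid = isCommutativeMonoidˡ (record
        { isSemigroup = record
          { isMagma = record { isEquivalence = ≈-isEquivalence ; ∙-cong = ⊛-cong }
          ; assoc = λ f g k → ≗⇒≈ (⊛-assoc f g k) }
        ; identityˡ = λ f → ≗⇒≈ (⊛-identityˡ f)
        ; comm = λ f g → ≗⇒≈ (⊛-comm f g) })
      ; distribʳ = λ f g k → ≗⇒≈ (⊛-distribʳ f g k)
      ; zeroˡ = λ f → ≗⇒≈ (λ h → sum-zero {n} _ (λ _ → refl)) })
    }

  module R = CommutativeSemiring semiring
  open SemiringExp R.semiring using (^-congˡ) renaming (_^_ to _^ᴿ_)
  open SemiringSum R.semiring using () renaming (sum to ∑ᴿ)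
  open SemiringMult R.semiring using () renaming (_×_ to _×ᴿ_)

  monoid : Monoid 0ℓ 0ℓ
  monoid = record { isMonoid = IsCommutativeMonoid.isMonoid isCommutativeMonoid }

  open MonoidMult monoid public using () renaming (_×_ to pow)
  open MonoidMult monoid using () renaming (×-homo-1 to pow-1; ×-assocˡ to pow-pow)

  formalSum : ∀ {m} → (Fin m → ℕ) → (Fin m → Fin n) → Element
  formalSum c φ h = sum (λ i → c i * [ φ i ≟ h ])

  monomial : ℕ → Fin n → Element
  monomial c a h = c * [ a ≟ h ]

  formalSum-⊛ : ∀ {m} (c : Fin m → ℕ) φ g h → (formalSum c φ ⊛ g) h ≡ sum (λ i → c i * sum (λ b → g b * [ φ i · b ≟ h ]))
  formalSum-⊛ c φ g h = ∑-pushforward c φ (λ a → sum (λ b → g b * [ a · b ≟ h ]))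

  formalSum-⊛-formalSum : ∀ {m} (c d : Fin m → ℕ) φ ψ h →
    (formalSum c φ ⊛ formalSum d ψ) h ≡ sum (λ i → c i * sum (λ j → d j * [ φ i · ψ j ≟ h ]))
  formalSum-⊛-formalSum {m} c d φ ψ h = trans (formalSum-⊛ c φ (formalSum d ψ) h)
    (sum-cong-≗ {m} (λ i → cong (c i *_) (∑-pushforward d ψ (λ b → [ φ i · b ≟ h ]))))

  δ-⊛-formalSum : ∀ {m} t (c : Fin m → ℕ) φ → δ t ⊛ formalSum c φ ≈ formalSum c ((t ·_) ∘ φ)
  δ-⊛-formalSum t c φ = ≗⇒≈ λ h → trans (δ-⊛ t (formalSum c φ) h) (∑-pushforward c φ (λ b → [ t · b ≟ h ]))

  ⊛≈𝟘⇒^⊛≈𝟘 : ∀ m → 0 < m → ∀ {x y} → x ⊛ y ≈ 𝟘 → x ^ᴿ m ⊛ y ≈ 𝟘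
  ⊛≈𝟘⇒^⊛≈𝟘 (suc m) _ {x} {y} xy≈𝟘 = begin
    x ⊛ x ^ᴿ m ⊛ y      ≈⟨ R.*-assoc x (x ^ᴿ m) y ⟩
    x ⊛ (x ^ᴿ m ⊛ y)    ≈⟨ R.*-congˡ {x} (R.*-comm (x ^ᴿ m) y) ⟩
    x ⊛ (y ⊛ x ^ᴿ m)    ≈⟨ R.*-assoc x y (x ^ᴿ m) ⟨
    x ⊛ y ⊛ x ^ᴿ m      ≈⟨ R.*-congʳ {x ^ᴿ m} xy≈𝟘 ⟩
    𝟘 ⊛ x ^ᴿ m          ≈⟨ R.zeroˡ (x ^ᴿ m) ⟩
    𝟘                   ∎
    where open SetoidReasoning R.setoid

  module Frobenius (q-prime : Prime q) where

    private
      0<q : 0 < q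
      0<q = <-trans (s≤s z≤n) (nonTrivial⇒n>1 q {{prime⇒nonTrivial q-prime}})

    ∑ᴿ-pointwise : ∀ {m} (f : Fin m → Element) h → ∑ᴿ f h ≡ sum (λ i → f i h)
    ∑ᴿ-pointwise {zero} f h = refl
    ∑ᴿ-pointwise {suc m} f h = cong (f zero h +_) (∑ᴿ-pointwise (f ∘ suc) h)

    ×ᴿ-pointwise : ∀ k f h → (k ×ᴿ f) h ≡ k * f h
    ×ᴿ-pointwise zero f h = refl
    ×ᴿ-pointwise (suc k) f h = cong (f h +_) (×ᴿ-pointwise k f h)

    -- All inner binomial coefficients (q C k), 0 < k < q, vanish modulo q.
    frobenius : ∀ x y → (x ⊕ y) ^ᴿ q ≈ x ^ᴿ q ⊕ y ^ᴿ q
    frobenius x y h = trans (Bin.theorem q x y h) (trans (cong (_% q) (∑ᴿ-pointwise (Bin.binomialTerm x y q) h))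
      (trans (~-sum-ends q term 0<q inner~0) (cong (_% q) (trans (cong₂ _+_ term₀ termq) (+-comm ((y ^ᴿ q) h) ((x ^ᴿ q) h))))))
      where
      module Bin = Binomial semiring
      term : Fin (suc q) → ℕ
      term i = Bin.binomialTerm x y q i h
      term≡ : ∀ i → term i ≡ (q C toℕ i) * (x ^ᴿ toℕ i ⊛ y ^ᴿ (q ∸ toℕ i)) h
      term≡ i = ×ᴿ-pointwise (q C toℕ i) _ h
      inner~0 : ∀ i → 0 < toℕ i → toℕ i < q → term i ~ 0
      inner~0 i 0<i i<q with prime∣pCk q-prime 0<i i<q
      ... | divides t qCi≡tq = trans (cong (_% q) (trans (term≡ i) (trans (cong (_* S) qCi≡tq)
              (trans (*-assoc t q S) (trans (cong (t *_) (*-comm q S)) (sym (*-assoc t S q)))))))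
              (trans (m*n%n≡0 (t * S) q) (sym (m*n%n≡0 0 q)))
        where S = (x ^ᴿ toℕ i ⊛ y ^ᴿ (q ∸ toℕ i)) h
      term₀ : term zero ≡ (y ^ᴿ q) h
      term₀ = trans (term≡ zero) (trans (*-identityˡ _) (⊛-identityˡ (y ^ᴿ q) h))
      termq : term (fromℕ q) ≡ (x ^ᴿ q) h
      termq = begin
        term (fromℕ q)                                          ≡⟨ term≡ (fromℕ q) ⟩
        (q C toℕ (fromℕ q)) * (x ^ᴿ toℕ (fromℕ q) ⊛ y ^ᴿ (q ∸ toℕ (fromℕ q))) h
                                                                ≡⟨ cong (λ k → (q C k) * (x ^ᴿ k ⊛ y ^ᴿ (q ∸ k)) h) (toℕ-fromℕ q) ⟩
        (q C q) * (x ^ᴿ q ⊛ y ^ᴿ (q ∸ q)) h                    ≡⟨ cong₂ (λ c k → c * (x ^ᴿ q ⊛ y ^ᴿ k) h) (nCn≡1 q) (n∸n≡0 q) ⟩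
        1 * (x ^ᴿ q ⊛ δ e) h                                   ≡⟨ *-identityˡ _ ⟩
        (x ^ᴿ q ⊛ δ e) h                                       ≡⟨ ⊛-comm (x ^ᴿ q) (δ e) h ⟩
        (δ e ⊛ x ^ᴿ q) h                                       ≡⟨ ⊛-identityˡ (x ^ᴿ q) h ⟩
        (x ^ᴿ q) h                                             ∎
        where open ≡-Reasoning

    𝟘^ : ∀ m → 0 < m → 𝟘 ^ᴿ m ≈ 𝟘
    𝟘^ (suc m) _ = R.zeroˡ (𝟘 ^ᴿ m)

    δ-^ : ∀ m a → δ a ^ᴿ m ≈ δ (pow m a)
    δ-^ zero a = R.refl
    δ-^ (suc m) a = R.trans (⊛-cong {δ a} R.refl (δ-^ m a)) (≗⇒≈ λ h → begin
      (δ a ⊛ δ (pow m a)) h                   ≡⟨ δ-⊛ a (δ (pow m a)) h ⟩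
      sum (λ b → [ pow m a ≟ b ] * [ a · b ≟ h ]) ≡⟨ sum-δ (pow m a) (λ b → [ a · b ≟ h ]) ⟩
      [ a · pow m a ≟ h ]                     ∎)
      where open ≡-Reasoning

    monomial-frobenius : ∀ c a → monomial c a ^ᴿ q ≈ monomial c (pow q a)
    monomial-frobenius zero a = R.trans (^-congˡ q {monomial 0 a} {𝟘} (λ h → refl)) (𝟘^ q 0<q)
    monomial-frobenius (suc c) a = begin
      monomial (suc c) a ^ᴿ q                  ≡⟨⟩
      (δ a ⊕ monomial c a) ^ᴿ q               ≈⟨ frobenius (δ a) (monomial c a) ⟩
      δ a ^ᴿ q ⊕ monomial c a ^ᴿ q            ≈⟨ ⊕-cong (δ-^ q a) (monomial-frobenius c a) ⟩
      δ (pow q a) ⊕ monomial c (pow q a)      ≡⟨⟩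
      monomial (suc c) (pow q a)              ∎
      where open SetoidReasoning R.setoid

    formalSum-frobenius : ∀ {m} (c : Fin m → ℕ) φ → formalSum c φ ^ᴿ q ≈ formalSum c (pow q ∘ φ)
    formalSum-frobenius {zero} c φ = 𝟘^ q 0<q
    formalSum-frobenius {suc m} c φ = R.trans (frobenius (monomial (c zero) (φ zero)) (formalSum (c ∘ suc) (φ ∘ suc)))
      (⊕-cong (monomial-frobenius (c zero) (φ zero)) (formalSum-frobenius (c ∘ suc) (φ ∘ suc)))

    formalSum-pow-annihilates : ∀ {m} (c : Fin m → ℕ) φ y → formalSum c φ ⊛ y ≈ 𝟘 →
                                ∀ i → formalSum c (pow (q ^ i) ∘ φ) ⊛ y ≈ 𝟘
    formalSum-pow-annihilates {m} c φ y cφy≈𝟘 zero =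
      R.trans (R.*-congʳ {y} (≗⇒≈ λ h → sum-cong-≗ {m} (λ j → cong (λ z → c j * [ z ≟ h ]) (pow-1 (φ j))))) cφy≈𝟘
    formalSum-pow-annihilates {m} c φ y cφy≈𝟘 (suc i) = begin
      formalSum c (pow (q * q ^ i) ∘ φ) ⊛ y           ≈⟨ R.*-congʳ {y} (≗⇒≈ λ h → sum-cong-≗ {m} (λ j → cong (λ z → c j * [ z ≟ h ]) (pow-pow (φ j) q (q ^ i)))) ⟨
      formalSum c (pow q ∘ pow (q ^ i) ∘ φ) ⊛ y       ≈⟨ R.*-congʳ {y} (formalSum-frobenius c (pow (q ^ i) ∘ φ)) ⟨
      formalSum c (pow (q ^ i) ∘ φ) ^ᴿ q ⊛ y          ≈⟨ ⊛≈𝟘⇒^⊛≈𝟘 q 0<q {formalSum c (pow (q ^ i) ∘ φ)} {y} (formalSum-pow-annihilates c φ y cφy≈𝟘 i) ⟩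
      𝟘                                               ∎
      where open SetoidReasoning R.setoid

sumList : ∀ {a} {A : Set a} → List A → (A → ℕ) → ℕ
sumList List.[] f = 0
sumList (x List.∷ xs) f = f x + sumList xs f

sumList-tabulate : ∀ {a} {A : Set a} {m} (g : Fin m → A) (f : A → ℕ) → sumList (tabulate g) f ≡ sum (f ∘ g)
sumList-tabulate {m = zero} g f = refl
sumList-tabulate {m = suc m} g f = cong (f (g zero) +_) (sumList-tabulate (g ∘ suc) f)

module _ {a b p} {A : Set a} {B : Set b} {P : Pred (A × B) p} (P? : Decidable₁ P) where

  length-filter-pairs : ∀ x (ys : List B) → length (filter P? (map (x ,_) ys)) ≡ sumList ys (λ y → [ P? (x , y) ])
  length-filter-pairs x List.[] = refl
  length-filter-pairs x (y List.∷ ys) with does (P? (x , y))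
  ... | true = cong suc (length-filter-pairs x ys)
  ... | false = length-filter-pairs x ys

  length-filter-cartesianProduct : ∀ (xs : List A) (ys : List B) →
    length (filter P? (cartesianProduct xs ys)) ≡ sumList xs (λ x → sumList ys (λ y → [ P? (x , y) ]))
  length-filter-cartesianProduct List.[] ys = refl
  length-filter-cartesianProduct (x List.∷ xs) ys = begin
    length (filter P? (map (x ,_) ys ++ cartesianProduct xs ys))
      ≡⟨ cong length (filter-++ P? (map (x ,_) ys) (cartesianProduct xs ys)) ⟩
    length (filter P? (map (x ,_) ys) ++ filter P? (cartesianProduct xs ys))
      ≡⟨ length-++ (filter P? (map (x ,_) ys)) ⟩
    length (filter P? (map (x ,_) ys)) + length (filter P? (cartesianProduct xs ys))
      ≡⟨ cong₂ _+_ (length-filter-pairs x ys) (length-filter-cartesianProduct xs ys) ⟩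
    sumList ys (λ y → [ P? (x , y) ]) + sumList xs (λ x → sumList ys (λ y → [ P? (x , y) ])) ∎
    where
    open ≡-Reasoning

χ : ∀ {n} → Subset n → Fin n → ℕ
χ A i = [ i ∈? A ]

∣∣≡∑χ : ∀ {n} (A : Subset n) → ∣ A ∣ ≡ sum (χ A)
∣∣≡∑χ [] = refl
∣∣≡∑χ (inside ∷ A) = cong suc (∣∣≡∑χ A)
∣∣≡∑χ (outside ∷ A) = ∣∣≡∑χ A

0<∣∣⇒nonempty : ∀ {n} (A : Subset n) → 0 < ∣ A ∣ → Nonempty A
0<∣∣⇒nonempty {n} A 0<∣A∣ = decidable-stable (nonempty? A) λ empty →
  <⇒≢ 0<∣A∣ (sym (trans (cong ∣_∣ (Empty-unique empty)) (∣⊥∣≡0 n)))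

∑-without-member : ∀ {n} {A : Subset n} {a} → a ∈ A → 1 + sum (λ x → (1 ∸ [ a ≟ x ]) * χ A x) ≡ ∣ A ∣
∑-without-member {n} {A} {a} a∈A = begin
  1 + sum (λ x → (1 ∸ [ a ≟ x ]) * χ A x)                         ≡⟨ cong (_+ sum (λ x → (1 ∸ [ a ≟ x ]) * χ A x)) (sym (trans (sum-δ a (χ A)) ([]≡1 (a ∈? A) a∈A))) ⟩
  sum (λ x → [ a ≟ x ] * χ A x) + sum (λ x → (1 ∸ [ a ≟ x ]) * χ A x) ≡⟨ ∑-split (λ x → [ a ≟ x ]) (χ A) (λ x → []≤1 (a ≟ x)) ⟩
  sum (χ A)                                                        ≡⟨ ∣∣≡∑χ A ⟨
  ∣ A ∣                                                            ∎
  where open ≡-Reasoning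

module EnumeratedGroup {c ℓ} (G : AbelianGroup c ℓ) {n} (F : FiniteOrder G n) where

  open AbelianGroup G using (Carrier; _∙_; ∙-congˡ; rawGroup)
    renaming (_≈_ to _≈ᴳ_; ε to εᴳ; _⁻¹ to _⁻¹ᴳ; trans to transᴳ; sym to symᴳ)
  open FiniteOrder F

  index : Carrier → Fin n
  index g = proj₁ (surjective g)

  enum-index : ∀ g → enum (index g) ≈ᴳ g
  enum-index g = proj₂ (surjective g)

  _·_ : Op₂ (Fin n)
  i · j = index (enum i ∙ enum j)

  ε : Fin n
  ε = index εᴳ

  _⁻¹ : Op₁ (Fin n)
  i ⁻¹ = index (enum i ⁻¹ᴳ)

  enum-isGroupMonomorphism : IsGroupMonomorphism (record { _≈_ = _≡_ ; _∙_ = _·_ ; ε = ε ; _⁻¹ = _⁻¹ }) rawGroup enum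
  enum-isGroupMonomorphism = record
    { isGroupHomomorphism = record
      { isMonoidHomomorphism = record
        { isMagmaHomomorphism = record
          { isRelHomomorphism = record { cong = λ { refl → AbelianGroup.refl G } }
          ; homo = λ i j → enum-index _ }
        ; ε-homo = enum-index εᴳ }
      ; ⁻¹-homo = λ i → enum-index _ }
    ; injective = injective _ _ }

  isAbelianGroup : IsAbelianGroup _≡_ _·_ ε _⁻¹
  isAbelianGroup = GroupMonomorphism.isAbelianGroup enum-isGroupMonomorphism (AbelianGroup.isAbelianGroup G)

  module _ (_≟ᴳ_ : Decidable _≈ᴳ_) (A₀ A₁ : Subset n) where

    diffCount≡ : ∀ {g} h → g ≈ᴳ enum h →
                 diffCount G _≟ᴳ_ F A₀ A₁ g ≡ sum (λ i → χ A₀ i * sum (λ j → χ A₁ j * [ i · (j ⁻¹) ≟ h ]))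
    diffCount≡ {g} h g≈h = begin
      diffCount G _≟ᴳ_ F A₀ A₁ g
        ≡⟨ length-filter-cartesianProduct _ (allFin n) (allFin n) ⟩
      sumList (allFin n) (λ i → sumList (allFin n) (λ j → [ pair? i j ]))
        ≡⟨ sumList-tabulate {m = n} id (λ i → sumList (allFin n) (λ j → [ pair? i j ])) ⟩
      sum (λ i → sumList (allFin n) (λ j → [ pair? i j ]))
        ≡⟨ sum-cong-≗ {n} (λ i → trans (sumList-tabulate {m = n} id (λ j → [ pair? i j ])) (sum-cong-≗ {n} (separate i))) ⟩
      sum (λ i → sum (λ j → χ A₀ i * (χ A₁ j * [ i · (j ⁻¹) ≟ h ])))
        ≡⟨ sum-cong-≗ {n} (λ i → *-distribˡ-sum {n} (χ A₀ i) _) ⟨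
      sum (λ i → χ A₀ i * sum (λ j → χ A₁ j * [ i · (j ⁻¹) ≟ h ])) ∎
      where
      open ≡-Reasoning
      difference? : ∀ i j → Dec ((enum i ∙ enum j ⁻¹ᴳ) ≈ᴳ g)
      difference? i j = (enum i ∙ enum j ⁻¹ᴳ) ≟ᴳ g
      pair? : ∀ i j → Dec (i ∈ A₀ × j ∈ A₁ × (enum i ∙ enum j ⁻¹ᴳ) ≈ᴳ g)
      pair? i j = (i ∈? A₀) ×-dec ((j ∈? A₁) ×-dec difference? i j)
      enum-·⁻¹ : ∀ i j → enum (i · (j ⁻¹)) ≈ᴳ enum i ∙ enum j ⁻¹ᴳ
      enum-·⁻¹ i j = transᴳ (enum-index _) (∙-congˡ (enum-index _))
      separate : ∀ i j → [ pair? i j ] ≡ χ A₀ i * (χ A₁ j * [ i · (j ⁻¹) ≟ h ])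
      separate i j = trans ([]-×-dec (i ∈? A₀) ((j ∈? A₁) ×-dec difference? i j))
        (cong (χ A₀ i *_) (trans ([]-×-dec (j ∈? A₁) (difference? i j)) (cong (χ A₁ j *_)
          ([]-cong (difference? i j) (i · (j ⁻¹) ≟ h)
            (λ ≈g → injective _ _ (transᴳ (enum-·⁻¹ i j) (transᴳ ≈g g≈h)))
            (λ { refl → transᴳ (symᴳ (enum-·⁻¹ i j)) (symᴳ g≈h) })))))

-- Strong external difference families in groups of prime order

module OrbitCongruence {p : ℕ} {_·_ : Op₂ (Fin p)} {ε : Fin p} {_⁻¹ : Op₁ (Fin p)}
                       (isAbelianGroup : IsAbelianGroup _≡_ _·_ ε _⁻¹) (p-prime : Prime p)
                       {q : ℕ} (q-prime : Prime q) (q-primitive : IsPrimitiveRoot q p) where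

  open IsAbelianGroup isAbelianGroup using (isCommutativeMonoid)
  open FiniteAbelianGroup isAbelianGroup using ([·⁻¹≟]≡[≟·]; [ε≟⁻¹·]≡[≟]; module PrimeOrder)
  open PrimeOrder p-prime using (module PrimitiveRoot)
  open PrimitiveRoot q-primitive using (orbit; fiber-orbit)

  private instance
    q≢0 = prime⇒nonZero q-prime

  open MonoidSemiring isCommutativeMonoid q public
  open Frobenius q-prime
  open Modulo q

  orbit-congruence : ∀ (c₀ c₁ : Fin p → ℕ) → formalSum c₀ id ⊛ formalSum c₁ _⁻¹ ≈ 𝟘 → ∀ a₀ b₀ →
    (p ∸ 1) * c₀ a₀ * c₁ b₀ + sum (λ a → (1 ∸ [ a₀ ≟ a ]) * c₀ a) * sum (λ b → (1 ∸ [ b₀ ≟ b ]) * c₁ b) ~ 0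
  orbit-congruence c₀ c₁ XY≈𝟘 a₀ b₀ = subst (_~ 0) orbitSum≡
    (trans (~-sum {p ∸ 1} _ (λ _ → 0) (λ i → Xᵢ⊛Y≈𝟘 (toℕ i) (b₀ ⁻¹))) (cong (_% q) (sum-zero {p ∸ 1} _ (λ _ → refl))))
    where
    Y : Element
    Y = formalSum c₁ _⁻¹

    X′⊛Y≈𝟘 : formalSum c₀ ((a₀ ⁻¹) ·_) ⊛ Y ≈ 𝟘
    X′⊛Y≈𝟘 = begin
      formalSum c₀ ((a₀ ⁻¹) ·_) ⊛ Y                   ≈⟨ R.*-congʳ {Y} (δ-⊛-formalSum (a₀ ⁻¹) c₀ id) ⟨
      δ (a₀ ⁻¹) ⊛ formalSum c₀ id ⊛ Y                  ≈⟨ R.*-assoc (δ (a₀ ⁻¹)) (formalSum c₀ id) Y ⟩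
      δ (a₀ ⁻¹) ⊛ (formalSum c₀ id ⊛ Y)                ≈⟨ R.*-congˡ {δ (a₀ ⁻¹)} XY≈𝟘 ⟩
      δ (a₀ ⁻¹) ⊛ 𝟘                                    ≈⟨ R.zeroʳ (δ (a₀ ⁻¹)) ⟩
      𝟘                                                ∎
      where open SetoidReasoning R.setoid

    Xᵢ⊛Y≈𝟘 : ∀ i → formalSum c₀ (pow (q ^ i) ∘ ((a₀ ⁻¹) ·_)) ⊛ Y ≈ 𝟘
    Xᵢ⊛Y≈𝟘 = formalSum-pow-annihilates c₀ ((a₀ ⁻¹) ·_) Y X′⊛Y≈𝟘

    orbitSum≡ : sum {p ∸ 1} (λ i → (formalSum c₀ (pow (q ^ toℕ i) ∘ ((a₀ ⁻¹) ·_)) ⊛ Y) (b₀ ⁻¹))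
              ≡ (p ∸ 1) * c₀ a₀ * c₁ b₀ + sum (λ a → (1 ∸ [ a₀ ≟ a ]) * c₀ a) * sum (λ b → (1 ∸ [ b₀ ≟ b ]) * c₁ b)
    orbitSum≡ = begin
      sum {p ∸ 1} (λ i → (formalSum c₀ (orbit′ i) ⊛ Y) (b₀ ⁻¹))
        ≡⟨ sum-cong-≗ {p ∸ 1} (λ i → formalSum-⊛-formalSum c₀ c₁ (orbit′ i) _⁻¹ (b₀ ⁻¹)) ⟩
      sum (λ i → sum (λ a → c₀ a * sum (λ b → c₁ b * [ orbit′ i a · (b ⁻¹) ≟ b₀ ⁻¹ ])))
        ≡⟨ ∑-pull-*ˡ c₀ (λ i a → sum (λ b → c₁ b * [ orbit′ i a · (b ⁻¹) ≟ b₀ ⁻¹ ])) ⟩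
      sum (λ a → c₀ a * sum (λ i → sum (λ b → c₁ b * [ orbit′ i a · (b ⁻¹) ≟ b₀ ⁻¹ ])))
        ≡⟨ sum-cong-≗ {p} (λ a → cong (c₀ a *_) (∑-pull-*ˡ c₁ (λ i b → [ orbit′ i a · (b ⁻¹) ≟ b₀ ⁻¹ ]))) ⟩
      sum (λ a → c₀ a * sum (λ b → c₁ b * sum (λ i → [ orbit′ i a · (b ⁻¹) ≟ b₀ ⁻¹ ])))
        ≡⟨ sum-cong-≗ {p} (λ a → cong (c₀ a *_) (sum-cong-≗ {p} (λ b → cong (c₁ b *_) (hits a b)))) ⟩
      sum (λ a → c₀ a * sum (λ b → c₁ b * ((p ∸ 1) * [ a₀ ≟ a ] * [ b₀ ≟ b ] + (1 ∸ [ a₀ ≟ a ]) * (1 ∸ [ b₀ ≟ b ]))))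
        ≡⟨ ∑∑-rank-two c₀ c₁ (p ∸ 1) (λ a → [ a₀ ≟ a ]) (λ a → 1 ∸ [ a₀ ≟ a ]) (λ b → [ b₀ ≟ b ]) (λ b → 1 ∸ [ b₀ ≟ b ]) ⟩
      (p ∸ 1) * sum (λ a → [ a₀ ≟ a ] * c₀ a) * sum (λ b → [ b₀ ≟ b ] * c₁ b) + L₀ * L₁
        ≡⟨ cong₂ (λ x y → (p ∸ 1) * x * y + L₀ * L₁) (sum-δ a₀ c₀) (sum-δ b₀ c₁) ⟩
      (p ∸ 1) * c₀ a₀ * c₁ b₀ + sum (λ a → (1 ∸ [ a₀ ≟ a ]) * c₀ a) * sum (λ b → (1 ∸ [ b₀ ≟ b ]) * c₁ b) ∎
      where
      open ≡-Reasoning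
      L₀ = sum (λ a → (1 ∸ [ a₀ ≟ a ]) * c₀ a)
      L₁ = sum (λ b → (1 ∸ [ b₀ ≟ b ]) * c₁ b)
      orbit′ : Fin (p ∸ 1) → Fin p → Fin p
      orbit′ i a = orbit ((a₀ ⁻¹) · a) i
      hits : ∀ a b → sum (λ i → [ orbit′ i a · (b ⁻¹) ≟ b₀ ⁻¹ ])
                   ≡ (p ∸ 1) * [ a₀ ≟ a ] * [ b₀ ≟ b ] + (1 ∸ [ a₀ ≟ a ]) * (1 ∸ [ b₀ ≟ b ])
      hits a b = begin
        sum {p ∸ 1} (λ i → [ orbit′ i a · (b ⁻¹) ≟ b₀ ⁻¹ ]) ≡⟨ sum-cong-≗ {p ∸ 1} (λ i → [·⁻¹≟]≡[≟·] (orbit′ i a) b (b₀ ⁻¹)) ⟩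
        fiber (orbit ((a₀ ⁻¹) · a)) ((b₀ ⁻¹) · b)        ≡⟨ fiber-orbit ((a₀ ⁻¹) · a) ((b₀ ⁻¹) · b) ⟩
        (p ∸ 1) * [ ε ≟ (a₀ ⁻¹) · a ] * [ ε ≟ (b₀ ⁻¹) · b ] + (1 ∸ [ ε ≟ (a₀ ⁻¹) · a ]) * (1 ∸ [ ε ≟ (b₀ ⁻¹) · b ])
          ≡⟨ cong₂ (λ x y → (p ∸ 1) * x * y + (1 ∸ x) * (1 ∸ y)) ([ε≟⁻¹·]≡[≟] a₀ a) ([ε≟⁻¹·]≡[≟] b₀ b) ⟩
        (p ∸ 1) * [ a₀ ≟ a ] * [ b₀ ≟ b ] + (1 ∸ [ a₀ ≟ a ]) * (1 ∸ [ b₀ ≟ b ]) ∎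

∣-shifted-square : ∀ {q p l} → 1 ≤ p → 1 ≤ l → q ∣ l → q ∣ (p ∸ 1) + (l ∸ 1) * (l ∸ 1) → q ∣ p
∣-shifted-square {q} {p} {suc L} 1≤p (s≤s z≤n) q∣l q∣shifted = subst (q ∣_) (m∸n+n≡m 1≤p)
  (∣m+n∣m⇒∣n (subst (q ∣_) (expand (p ∸ 1) L) (∣m∣n⇒∣m+n q∣shifted (∣n⇒∣m*n 2 q∣l))) (∣m⇒∣m*n (suc L) q∣l))
  where
  expand : ∀ P L → P + L * L + 2 * (1 + L) ≡ (1 + L) * (1 + L) + (P + 1)
  expand = solve-∀

module SEDF {c ℓ} (G : AbelianGroup c ℓ) (_≟ᴳ_ : Decidable (AbelianGroup._≈_ G)) {n} (F : FiniteOrder G n)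
            {l λ′ : ℕ} {A₀ A₁ : Subset n} (sedf : IsSEDF G _≟ᴳ_ F l λ′ A₀ A₁) where

  open AbelianGroup G using () renaming (refl to reflᴳ; sym to symᴳ; trans to transᴳ)
  open FiniteOrder F using (enum; injective)
  open EnumeratedGroup G F
  open IsSEDF sedf

  difference-count : ∀ h → sum (λ i → χ A₀ i * sum (λ j → χ A₁ j * [ i · (j ⁻¹) ≟ h ])) ≡ λ′ * (1 ∸ [ ε ≟ h ])
  difference-count h with ε ≟ h
  ... | yes refl = trans (sym (diffCount≡ _≟ᴳ_ A₀ A₁ ε (symᴳ (enum-index _)))) (trans identity₀₁ (sym (*-zeroʳ λ′)))
  ... | no ε≢h = trans (sym (diffCount≡ _≟ᴳ_ A₀ A₁ h reflᴳ))
                   (trans (other₀₁ (enum h) (λ h≈ε → ε≢h (injective ε h (transᴳ (enum-index _) (symᴳ h≈ε)))))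
                     (sym (*-identityʳ λ′)))

  module _ (n-prime : Prime n) {q} (q-prime : Prime q) (q-primitive : IsPrimitiveRoot q n) (q∣λ′ : q ∣ λ′) where

    open OrbitCongruence isAbelianGroup n-prime q-prime q-primitive

    private instance
      q≢0 = prime⇒nonZero q-prime

    open Modulo q

    difference-product≈𝟘 : formalSum (χ A₀) id ⊛ formalSum (χ A₁) _⁻¹ ≈ 𝟘
    difference-product≈𝟘 h = ∣⇒~0 (subst (q ∣_)
      (sym (trans (formalSum-⊛-formalSum (χ A₀) (χ A₁) id _⁻¹ h) (difference-count h))) (∣m⇒∣m*n _ q∣λ′))

    shifted-square-congruence : Nonempty A₀ → Nonempty A₁ → q ∣ (n ∸ 1) + (l ∸ 1) * (l ∸ 1)
    shifted-square-congruence (a₀ , a₀∈A₀) (b₀ , b₀∈A₁) = subst (q ∣_)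
      (cong₂ _+_ (unit-coefficients ([]≡1 (a₀ ∈? A₀) a₀∈A₀) ([]≡1 (b₀ ∈? A₁) b₀∈A₁))
                 (cong₂ _*_ (size-without a₀∈A₀ size₀) (size-without b₀∈A₁ size₁)))
      (~0⇒∣ (orbit-congruence (χ A₀) (χ A₁) difference-product≈𝟘 a₀ b₀))
      where
      unit-coefficients : ∀ {x y} → x ≡ 1 → y ≡ 1 → (n ∸ 1) * x * y ≡ n ∸ 1
      unit-coefficients refl refl = trans (*-identityʳ _) (*-identityʳ _)
      size-without : ∀ {A a} → a ∈ A → ∣ A ∣ ≡ l → sum (λ x → (1 ∸ [ a ≟ x ]) * χ A x) ≡ l ∸ 1
      size-without a∈A ∣A∣≡l = trans (sym (m+n∸m≡n 1 _)) (cong (_∸ 1) (trans (∑-without-member a∈A) ∣A∣≡l))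

corollary3 : ∀ (p λ' l : ℕ) → Prime p → 1 ≤ λ' → 2 ≤ l → 2 * l ≤ p →
    λ' * (p ∸ 1) ≡ l * l →
    (∃[ q ] (Prime q × q ∣ λ' × IsPrimitiveRoot q p)) →
    ∀ {c ℓ : Level} (G : AbelianGroup c ℓ) (_≟_ : Decidable (AbelianGroup._≈_ G))
      (F : FiniteOrder G p) (A₀ A₁ : Subset p) →
    ¬ IsSEDF G _≟_ F l λ' A₀ A₁
corollary3 p λ′ l p-prime _ 2≤l _ λ′[p∸1]≡l*l (q , q-prime , q∣λ′ , q-primitive) G _≟ᴳ_ F A₀ A₁ sedf =
  [ q≢1 , q≢p ]′ (prime⇒irreducible p-prime q∣p)
  where
  open SEDF G _≟ᴳ_ F sedf
  open IsSEDF sedf using (size₀; size₁)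

  0<l : 0 < l
  0<l = <-≤-trans (s≤s z≤n) 2≤l

  nonempty : ∀ {A} → ∣ A ∣ ≡ l → Nonempty A
  nonempty {A} ∣A∣≡l = 0<∣∣⇒nonempty A (subst (0 <_) (sym ∣A∣≡l) 0<l)

  q∣l : q ∣ l
  q∣l = [ id , id ]′ (euclidsLemma l l q-prime (subst (q ∣_) λ′[p∸1]≡l*l (∣m⇒∣m*n (p ∸ 1) q∣λ′)))

  q∣p : q ∣ p
  q∣p = ∣-shifted-square (<⇒≤ (nonTrivial⇒n>1 p {{prime⇒nonTrivial p-prime}})) 0<l q∣l
          (shifted-square-congruence p-prime q-prime q-primitive q∣λ′ (nonempty size₀) (nonempty size₁))

  q≢1 : q ≢ 1
  q≢1 refl = <⇒≢ (nonTrivial⇒n>1 1 {{prime⇒nonTrivial q-prime}}) refl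

  q≢p : q ≢ p
  q≢p refl = proj₁ q-primitive ∣-refl
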